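{- Let $R$ be a subdirect product of SBM algebras $\mathbb{A}_1,\dots,\mathbb{A}_n$, let $i,j\in[n]$, let $\alpha,\beta$ be congruences of $\mathbb{A}_i$ with $\alpha\prec\beta\subseteq\theta_{\mathbb{A}_i}$, and let $\gamma,\delta$ be congruences of $\mathbb{A}_j$ with $\gamma\prec\delta\subseteq\theta_{\mathbb{A}_j}$. If $(\alpha,\beta)$ can be separated from $(\gamma,\delta)$ in $R$, then there is a unary polynomial $\mathbf{f}$ of $R$ that separates $(\alpha,\beta)$ from $(\gamma,\delta)$ and such that $f_\ell(A_\ell)\subseteq\max(\mathbb{A}_\ell)$ for every $\ell\in[n]$.
   Context: SBM algebras (paper's convention): an SBM algebra is a finite idempotent algebra $\mathbb{A}=(A;\cdot,m)$ with binary $\cdot$ (juxtaposition) and ternary $m$ as its basic operations and a congruence $\sigma_{\mathbb{A}}$ such that $\mathbb{A}/\sigma_{\mathbb{A}}$ is term equivalent to a semilattice with operation induced by $\cdot$, $xy=x$ and $m$ Mal'tsev on each $\sigma_{\mathbb{A}}$-block, $x(xy)=xy$, and $m(a,b,c)\,\sigma_{\mathbb{A}}\,(ab)c$. $\max(\mathbb{A})$ is the $\sigma_{\mathbb{A}}$-block that is the greatest element of $\mathbb{A}/\sigma_{\mathbb{A}}$ (order $u\le v$ iff $uv=v$); $\theta_{\mathbb{A}}$ is the equivalence with blocks $\max(\mathbb{A})$ and singletons outside it. A subdirect product $R$ of $\mathbb{A}_1,\dots,\mathbb{A}_n$ is a subalgebra of the product with all coordinate projections surjective. $\alpha\prec\beta$: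 $\alpha<\beta$ with nothing strictly between. A unary polynomial of $R$ is $\mathbf{f}(x)=t(x,\mathbf{a}^1,\dots,\mathbf{a}^l)$, $t$ a term operation, $\mathbf{a}^k\in R$; $f_\ell$ is the polynomial $t(x,\mathbf{a}^1[\ell],\dots,\mathbf{a}^l[\ell])$ of $\mathbb{A}_\ell$. $f(\beta)\subseteq\alpha$ means $(a,b)\in\beta\Rightarrow(f(a),f(b))\in\alpha$. $\mathbf{f}$ separates $(\alpha,\beta)$ from $(\gamma,\delta)$ if $f_i(\beta)\not\subseteq\alpha$ and $f_j(\delta)\subseteq\gamma$; $(\alpha,\beta)$ can be separated from $(\gamma,\delta)$ in $R$ if such $\mathbf{f}$ exists. -}

module Defs where

open import Data.Nat using (ℕ; suc)
open import Data.Fin using (Fin; zero; suc)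
open import Data.Product using (Σ; ∃; _×_; _,_)
open import Data.Sum using (_⊎_)
open import Relation.Nullary using (¬_)
open import Relation.Binary.PropositionalEquality using (_≡_)
open import Relation.Binary.Core using (Rel)
open import Relation.Binary.Structures using (IsEquivalence)
open import Level using (0ℓ)

record Alg : Set where
  field
    pred-size : ℕ
    _·_ : Fin (suc pred-size) → Fin (suc pred-size) → Fin (suc pred-size)
    m   : Fin (suc pred-size) → Fin (suc pred-size) → Fin (suc pred-size) → Fin (suc pred-size)

  Carrier : Set
  Carrier = Fin (suc pred-size)

  infixl 7 _·_

record IsCongruence (A : Alg) (θ : Rel (Alg.Carrier A) 0ℓ) : Set where
  open Alg A
  field
    isEquivalence : IsEquivalence θ
    ·-compat : ∀ {x x′ y y′} → θ x x′ → θ y y′ → θ (x · y) (x′ · y′)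
    m-compat : ∀ {x x′ y y′ z z′} → θ x x′ → θ y y′ → θ z z′ →
               θ (m x y z) (m x′ y′ z′)

record IsSBM (A : Alg) : Set₁ where
  open Alg A
  field
    σ : Rel Carrier 0ℓ
    σ-congruence : IsCongruence A σ
    ·-idem : ∀ x → x · x ≡ x
    m-idem : ∀ x → m x x x ≡ x
    -- A/σ with the operation induced by · is a semilattice
    -- (idempotence is inherited from ·-idem); by m-σ below, the
    -- operation induced by m is the semilattice term (xy)z, so A/σ is
    -- term equivalent to this semilattice.
    ·-comm-σ  : ∀ x y → σ (x · y) (y · x)
    ·-assoc-σ : ∀ x y z → σ ((x · y) · z) (x · (y · z))
    ·-left-block : ∀ x y → σ x y → x · y ≡ x
    m-maltsev₁ : ∀ x y → σ x y → m x y y ≡ x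
    m-maltsev₂ : ∀ x y → σ x y → m y y x ≡ x
    ·-absorb : ∀ x y → x · (x · y) ≡ x · y
    m-σ : ∀ a b c → σ (m a b c) ((a · b) · c)

record SBM : Set₁ where
  field
    alg : Alg
    isSBM : IsSBM alg
  open Alg alg public
  open IsSBM isSBM public

module _ (A : SBM) where
  open SBM A

  Con : Set₁
  Con = Σ (Rel Carrier 0ℓ) (IsCongruence alg)

  -- the σ-block that is greatest in A/σ, ordering u ≤ v iff uv = v
  -- (i.e. [a] is greatest iff [b][a] = [a] for all b)
  inMax : Carrier → Set
  inMax a = ∀ b → σ (b · a) a

  θ : Rel Carrier 0ℓ
  θ a b = a ≡ b ⊎ (inMax a × inMax b)

_⊆ᵣ_ : {C : Set} → Rel C 0ℓ → Rel C 0ℓ → Set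
α ⊆ᵣ β = ∀ {a b} → α a b → β a b

-- covering relation α ≺ β in the congruence lattice of A
-- (α, β themselves are required to be congruences separately)
Covers : (A : SBM) → Rel (SBM.Carrier A) 0ℓ → Rel (SBM.Carrier A) 0ℓ → Set₁
Covers A α β =
  (α ⊆ᵣ β) × (∃ λ a → ∃ λ b → β a b × ¬ α a b) ×
  (∀ (γ : Rel (SBM.Carrier A) 0ℓ) → IsCongruence (SBM.alg A) γ →
     α ⊆ᵣ γ → γ ⊆ᵣ β → (γ ⊆ᵣ α) ⊎ (β ⊆ᵣ γ))

data Term (V : ℕ) : Set where
  var : Fin V → Term V
  _∙_ : Term V → Term V → Term V
  mt  : Term V → Term V → Term V → Term V

eval : ∀ {V} (A : Alg) → Term V → (Fin V → Alg.Carrier A) → Alg.Carrier A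
eval A (var v) ρ = ρ v
eval A (s ∙ t) ρ = Alg._·_ A (eval A s ρ) (eval A t ρ)
eval A (mt s t u) ρ = Alg.m A (eval A s ρ) (eval A t ρ) (eval A u ρ)

module _ {n : ℕ} (A : Fin n → SBM) where

  Tuple : Set
  Tuple = (ℓ : Fin n) → SBM.Carrier (A ℓ)

  record IsSubdirect (R : Tuple → Set) : Set where
    field
      ·-closed : ∀ {a b} → R a → R b → R (λ ℓ → SBM._·_ (A ℓ) (a ℓ) (b ℓ))
      m-closed : ∀ {a b c} → R a → R b → R c →
                 R (λ ℓ → SBM.m (A ℓ) (a ℓ) (b ℓ) (c ℓ))
      surjective : ∀ ℓ (x : SBM.Carrier (A ℓ)) → ∃ λ a → R a × a ℓ ≡ x

  -- unary polynomial f(x) = t(x, a¹, …, aˡ) of R, with aᵏ ∈ R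
  record UnaryPoly (R : Tuple → Set) : Set where
    field
      arity : ℕ
      term  : Term (suc arity)
      params : Fin arity → Tuple
      params∈R : ∀ k → R (params k)

  coord : {R : Tuple → Set} → UnaryPoly R → (ℓ : Fin n) →
          SBM.Carrier (A ℓ) → SBM.Carrier (A ℓ)
  coord f ℓ x = eval (SBM.alg (A ℓ)) (UnaryPoly.term f) env
    where
      env : Fin (suc (UnaryPoly.arity f)) → SBM.Carrier (A ℓ)
      env zero = x
      env (suc k) = UnaryPoly.params f k ℓ

  MapsInto : {C : Set} → (C → C) → Rel C 0ℓ → Rel C 0ℓ → Set
  MapsInto g β α = ∀ a b → β a b → α (g a) (g b)

  Separates : {R : Tuple → Set} → UnaryPoly R →
              (i : Fin n) → Rel (SBM.Carrier (A i)) 0ℓ → Rel (SBM.Carrier (A i)) 0ℓ →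
              (j : Fin n) → Rel (SBM.Carrier (A j)) 0ℓ → Rel (SBM.Carrier (A j)) 0ℓ → Set
  Separates f i α β j γ δ =
    ¬ MapsInto (coord f i) β α × MapsInto (coord f j) δ γ

  CanSeparate : (R : Tuple → Set) →
                (i : Fin n) → Rel (SBM.Carrier (A i)) 0ℓ → Rel (SBM.Carrier (A i)) 0ℓ →
                (j : Fin n) → Rel (SBM.Carrier (A j)) 0ℓ → Rel (SBM.Carrier (A j)) 0ℓ → Set
  CanSeparate R i α β j γ δ = ∃ λ (f : UnaryPoly R) → Separates f i α β j γ δ

-- Multiplying a separating polynomial on the right by a tuple z ∈ R that lies in max(𝔸ℓ) in
-- every coordinate pushes all its values into the maximal blocks, since y·z ∈ max whenever
-- z ∈ max. It still separates: on 𝔸ⱼ right multiplication preserves γ, and on 𝔸ᵢ the pairs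
-- f(β) ⊆ θ are either equal or lie in max(𝔸ᵢ), where x·z = x, so nothing is collapsed into α.
-- Such a z is obtained as a long product of elements of R: by surjectivity every element of
-- every factor occurs in some coordinate, and multiplying by it on the right makes the product
-- σ-above it, while staying σ-above everything it was already above.
module Submission where

open import Defs
open import Data.Nat using (ℕ; zero; suc)
open import Data.Fin using (Fin; zero; suc; punchIn)
open import Data.Product using (∃; _×_; _,_)
open import Data.Sum using (inj₁; inj₂)
open import Relation.Binary.Core using (Rel)
open import Relation.Binary.Structures using (IsEquivalence)
open import Relation.Binary.PropositionalEquality
  using (_≡_; refl; sym; cong; cong₂; subst; subst₂)
open import Level using (0ℓ)

rename : ∀ {V W} → (Fin V → Fin W) → Term V → Term W
rename ρ (var v) = var (ρ v)
rename ρ (s ∙ t) = rename ρ s ∙ rename ρ t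
rename ρ (mt s t u) = mt (rename ρ s) (rename ρ t) (rename ρ u)

module _ (A : Alg) where
  open Alg A

  eval-rename : ∀ {V W} (ρ : Fin V → Fin W) (t : Term V)
                (env : Fin W → Carrier) (env′ : Fin V → Carrier) →
                (∀ v → env (ρ v) ≡ env′ v) → eval A (rename ρ t) env ≡ eval A t env′
  eval-rename ρ (var v) env env′ e = e v
  eval-rename ρ (s ∙ t) env env′ e =
    cong₂ _·_ (eval-rename ρ s env env′ e) (eval-rename ρ t env env′ e)
  eval-rename ρ (mt s t u) env env′ e
    rewrite eval-rename ρ s env env′ e | eval-rename ρ t env env′ e
          | eval-rename ρ u env env′ e = refl

  eval-cong : ∀ {V} {ψ : Rel Carrier 0ℓ} → IsCongruence A ψ →
              (t : Term V) (env env′ : Fin V → Carrier) →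
              (∀ v → ψ (env v) (env′ v)) → ψ (eval A t env) (eval A t env′)
  eval-cong C (var v) env env′ e = e v
  eval-cong C (s ∙ t) env env′ e =
    IsCongruence.·-compat C (eval-cong C s env env′ e) (eval-cong C t env env′ e)
  eval-cong C (mt s t u) env env′ e =
    IsCongruence.m-compat C (eval-cong C s env env′ e) (eval-cong C t env env′ e)
                            (eval-cong C u env env′ e)

module _ {X : Set} (R : X → Set) (_≼_ : X → X → Set)
         (≼-refl : ∀ {x} → x ≼ x) (≼-trans : ∀ {x y z} → x ≼ y → y ≼ z → x ≼ z) where

  achieve-all : ∀ {m} (P : Fin m → X → Set) →
                (∀ k {x y} → x ≼ y → P k x → P k y) →
                (∀ k x → R x → ∃ λ y → R y × x ≼ y × P k y) →
                ∀ x → R x → ∃ λ y → R y × x ≼ y × (∀ k → P k y)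
  achieve-all {zero} P mono achieve x x∈R = x , x∈R , ≼-refl , λ ()
  achieve-all {suc m} P mono achieve x x∈R
    with achieve-all (λ k → P (suc k)) (λ k → mono (suc k)) (λ k → achieve (suc k)) x x∈R
  ... | y , y∈R , x≼y , Py with achieve zero y y∈R
  ... | w , w∈R , y≼w , P₀w =
    w , w∈R , ≼-trans x≼y y≼w , λ { zero → P₀w ; (suc k) → mono (suc k) y≼w (Py k) }

module SBMOrder (A : SBM) where
  open SBM A
  private
    module σ = IsEquivalence (IsCongruence.isEquivalence σ-congruence)
    ·-congσ = IsCongruence.·-compat σ-congruence

  infix 4 _≤_
  _≤_ : Carrier → Carrier → Set
  x ≤ y = σ (x · y) y

  x≤y·x : ∀ x y → x ≤ y · x
  x≤y·x x y =
    σ.trans (·-comm-σ x (y · x)) (σ.trans (·-assoc-σ y x x) (σ.reflexive (cong (y ·_) (·-idem x))))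

  c≤y⇒c≤y·w : ∀ {c y} w → c ≤ y → c ≤ y · w
  c≤y⇒c≤y·w {c} {y} w c≤y = σ.trans (σ.sym (·-assoc-σ c y w)) (·-congσ c≤y σ.refl)

  inMax-·ʳ : ∀ y {z} → inMax A z → inMax A (y · z)
  inMax-·ʳ y z-max c = σ.trans (·-congσ σ.refl (z-max y)) (σ.trans (z-max c) (σ.sym (z-max y)))

  inMax-identityʳ : ∀ {x z} → inMax A x → inMax A z → x · z ≡ x
  inMax-identityʳ {x} {z} x-max z-max =
    ·-left-block x z (σ.trans (σ.sym (x-max z)) (σ.trans (σ.sym (·-comm-σ x z)) (z-max x)))

  θ-reflects-·inMax : ∀ {α : Rel Carrier 0ℓ} → IsCongruence alg α →
                      ∀ {z a b} → inMax A z → θ A a b → α (a · z) (b · z) → α a b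
  θ-reflects-·inMax Cα _ (inj₁ refl) _ = IsEquivalence.refl (IsCongruence.isEquivalence Cα)
  θ-reflects-·inMax {α} _ z-max (inj₂ (a-max , b-max)) α-az-bz =
    subst₂ α (inMax-identityʳ a-max z-max) (inMax-identityʳ b-max z-max) α-az-bz

module _ {n : ℕ} (A : Fin n → SBM) (R : Tuple A → Set) where
  ≤-at : (ℓ : Fin n) → SBM.Carrier (A ℓ) → SBM.Carrier (A ℓ) → Set
  ≤-at ℓ = SBMOrder._≤_ (A ℓ)
  syntax ≤-at ℓ c x = c ≤[ ℓ ] x

  _⊙_ : Tuple A → Tuple A → Tuple A
  (x ⊙ y) ℓ = SBM._·_ (A ℓ) (x ℓ) (y ℓ)

  _≼_ : Tuple A → Tuple A → Set
  x ≼ y = ∀ ℓ c → c ≤[ ℓ ] x ℓ → c ≤[ ℓ ] y ℓ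

  ≼-refl : ∀ {x} → x ≼ x
  ≼-refl ℓ c c≤x = c≤x

  ≼-trans : ∀ {x y z} → x ≼ y → y ≼ z → x ≼ z
  ≼-trans x≼y y≼z ℓ c c≤x = y≼z ℓ c (x≼y ℓ c c≤x)

  x≼x⊙y : ∀ x y → x ≼ (x ⊙ y)
  x≼x⊙y x y ℓ c = SBMOrder.c≤y⇒c≤y·w (A ℓ) (y ℓ)

  module _ (S : IsSubdirect A R) where
    open IsSubdirect S

    raise-above : ∀ ℓ b x → R x → ∃ λ y → R y × x ≼ y × b ≤[ ℓ ] y ℓ
    raise-above ℓ b x x∈R with surjective ℓ b
    ... | r , r∈R , refl = x ⊙ r , ·-closed x∈R r∈R , x≼x⊙y x r , SBMOrder.x≤y·x (A ℓ) (r ℓ) (x ℓ)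

    raise-to-max : ∀ ℓ x → R x → ∃ λ y → R y × x ≼ y × inMax (A ℓ) (y ℓ)
    raise-to-max ℓ = achieve-all R _≼_ ≼-refl ≼-trans
                       (λ b y → b ≤[ ℓ ] y ℓ) (λ b x≼y → x≼y ℓ b) (raise-above ℓ)

    max-element : Fin n → ∃ λ z → R z × (∀ ℓ → inMax (A ℓ) (z ℓ))
    max-element i with surjective i zero
    ... | x , x∈R , _ with achieve-all R _≼_ ≼-refl ≼-trans
                             (λ ℓ y → inMax (A ℓ) (y ℓ)) (λ ℓ x≼y y-max b → x≼y ℓ b (y-max b))
                             raise-to-max x x∈R
    ... | z , z∈R , _ , z-max = z , z∈R , z-max

  -- x ↦ f(x)·z, where z becomes parameter 1 and f's parameters are shifted by one
  _·ᵖ_ : UnaryPoly A R → ∀ {z} → R z → UnaryPoly A R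
  _·ᵖ_ f {z} z∈R = record
    { arity = suc (UnaryPoly.arity f)
    ; term = rename (punchIn (suc zero)) (UnaryPoly.term f) ∙ var (suc zero)
    ; params = λ { zero → z ; (suc k) → UnaryPoly.params f k }
    ; params∈R = λ { zero → z∈R ; (suc k) → UnaryPoly.params∈R f k }
    }

  coord-·ᵖ : ∀ f {z} (z∈R : R z) ℓ x →
             coord A (f ·ᵖ z∈R) ℓ x ≡ SBM._·_ (A ℓ) (coord A f ℓ x) (z ℓ)
  coord-·ᵖ f {z} z∈R ℓ x =
    cong (λ y → SBM._·_ (A ℓ) y (z ℓ))
      (eval-rename (SBM.alg (A ℓ)) (punchIn (suc zero)) (UnaryPoly.term f) _ _
                   λ { zero → refl ; (suc k) → refl })

  coord-cong : ∀ (f : UnaryPoly A R) ℓ {ψ : Rel (SBM.Carrier (A ℓ)) 0ℓ} →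
               IsCongruence (SBM.alg (A ℓ)) ψ → MapsInto A (coord A f ℓ) ψ ψ
  coord-cong f ℓ Cψ a b ψab = eval-cong (SBM.alg (A ℓ)) Cψ (UnaryPoly.term f) _ _
    λ { zero → ψab ; (suc k) → IsEquivalence.refl (IsCongruence.isEquivalence Cψ) }

  module _ (f : UnaryPoly A R) {z} (z∈R : R z) where

    ·ᵖ-inMax : (∀ ℓ → inMax (A ℓ) (z ℓ)) → ∀ ℓ x → inMax (A ℓ) (coord A (f ·ᵖ z∈R) ℓ x)
    ·ᵖ-inMax z-max ℓ x = subst (inMax (A ℓ)) (sym (coord-·ᵖ f z∈R ℓ x))
                           (SBMOrder.inMax-·ʳ (A ℓ) (coord A f ℓ x) (z-max ℓ))

    ·ᵖ-preserves : ∀ ℓ {γ δ : Rel (SBM.Carrier (A ℓ)) 0ℓ} → IsCongruence (SBM.alg (A ℓ)) γ →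
                   MapsInto A (coord A f ℓ) δ γ → MapsInto A (coord A (f ·ᵖ z∈R) ℓ) δ γ
    ·ᵖ-preserves ℓ {γ} Cγ f-δγ a b δab =
      subst₂ γ (sym (coord-·ᵖ f z∈R ℓ a)) (sym (coord-·ᵖ f z∈R ℓ b))
        (IsCongruence.·-compat Cγ (f-δγ a b δab) (IsEquivalence.refl (IsCongruence.isEquivalence Cγ)))

    ·ᵖ-reflects : ∀ ℓ {α β : Rel (SBM.Carrier (A ℓ)) 0ℓ} →
                  IsCongruence (SBM.alg (A ℓ)) α → IsCongruence (SBM.alg (A ℓ)) β →
                  β ⊆ᵣ θ (A ℓ) → inMax (A ℓ) (z ℓ) →
                  MapsInto A (coord A (f ·ᵖ z∈R) ℓ) β α → MapsInto A (coord A f ℓ) β α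
    ·ᵖ-reflects ℓ {α} Cα Cβ β⊆θ zℓ-max g-βα a b βab =
      SBMOrder.θ-reflects-·inMax (A ℓ) Cα zℓ-max (β⊆θ (coord-cong f ℓ Cβ a b βab))
        (subst₂ α (coord-·ᵖ f z∈R ℓ a) (coord-·ᵖ f z∈R ℓ b) (g-βα a b βab))

lemma14 : {n : ℕ} (A : Fin n → SBM) (R : Tuple A → Set) → IsSubdirect A R →
          (i j : Fin n) →
          (α β : Rel (SBM.Carrier (A i)) 0ℓ) →
          IsCongruence (SBM.alg (A i)) α → IsCongruence (SBM.alg (A i)) β →
          Covers (A i) α β → β ⊆ᵣ θ (A i) →
          (γ δ : Rel (SBM.Carrier (A j)) 0ℓ) →
          IsCongruence (SBM.alg (A j)) γ → IsCongruence (SBM.alg (A j)) δ →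
          Covers (A j) γ δ → δ ⊆ᵣ θ (A j) →
          CanSeparate A R i α β j γ δ →
          ∃ λ (f : UnaryPoly A R) →
            Separates A f i α β j γ δ ×
            (∀ (ℓ : Fin n) (x : SBM.Carrier (A ℓ)) → inMax (A ℓ) (coord A f ℓ x))
lemma14 A R S i j α β Cα Cβ _ β⊆θ γ δ Cγ _ _ _ (f , f-sep-i , f-sep-j)
  with max-element A R S i
... | z , z∈R , z-max =
  _·ᵖ_ A R f z∈R ,
  ((λ g-βα → f-sep-i (·ᵖ-reflects A R f z∈R i Cα Cβ β⊆θ (z-max i) g-βα)) ,
   ·ᵖ-preserves A R f z∈R j Cγ f-sep-j) ,
  ·ᵖ-inMax A R f z∈R z-max
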